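{- For integers $n\ge 0$ and $q\ge 0$ define the associated Motzkin numbers $$m_n^{(q)}=n!\sum_{r=0}^{\lfloor n/2\rfloor}\frac{1}{(n-2r)!\,r!\,(r+q)!},$$ let $m_n=m_n^{(1)}$ be the Motzkin numbers, and for integers $p,n,t\ge 0$ put $$M_{p,n,t}=p!\sum_{r=0}^{\lfloor p/2\rfloor}\frac{m_n^{(t+r+1)}}{(p-2r)!\,r!}.$$ Then for all integers $n,p\ge 0$, $$m_{n+p}=\sum_{s=0}^{\min(n,p)}2^{s}\,s!\binom{p}{s}\binom{n}{s}M_{p-s,\,n-s,\,s}.$$ -}

module Defs where

open import Data.Nat as ℕ using (ℕ; zero; suc; _∸_; _⊓_; NonZero)
open import Data.Nat.Properties using (_!≢0; m*n≢0)
open import Data.Nat.Combinatorics using (_C_)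
open import Data.Integer using (+_)
open import Data.Rational using (ℚ; 0ℚ; _+_; _*_; _/_)

sumTo : ℕ → (ℕ → ℚ) → ℚ
sumTo zero    f = f 0
sumTo (suc k) f = sumTo k f + f (suc k)

ℕtoℚ : ℕ → ℚ
ℕtoℚ n = (+ n) / 1

mTerm : ℕ → ℕ → ℕ → ℚ
mTerm n q r = ((+ (n ℕ.!)) / (a ℕ.* b ℕ.* c)) {{nz}}
  where
  a = (n ∸ 2 ℕ.* r) ℕ.!
  b = r ℕ.!
  c = (r ℕ.+ q) ℕ.!
  nz : NonZero (a ℕ.* b ℕ.* c)
  nz = m*n≢0 (a ℕ.* b) c {{m*n≢0 a b {{(n ∸ 2 ℕ.* r) !≢0}} {{r !≢0}}}} {{(r ℕ.+ q) !≢0}}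

assocMotzkin : ℕ → ℕ → ℚ
assocMotzkin n q = sumTo (n ℕ./ 2) (mTerm n q)

motzkin : ℕ → ℚ
motzkin n = assocMotzkin n 1

pTerm : ℕ → ℕ → ℚ
pTerm p r = ((+ (p ℕ.!)) / (a ℕ.* b)) {{m*n≢0 a b {{(p ∸ 2 ℕ.* r) !≢0}} {{r !≢0}}}}
  where
  a = (p ∸ 2 ℕ.* r) ℕ.!
  b = r ℕ.!

bigM : ℕ → ℕ → ℕ → ℚ
bigM p n t = sumTo (p ℕ./ 2) (λ r → pTerm p r * assocMotzkin n (t ℕ.+ r ℕ.+ 1))

rhs : ℕ → ℕ → ℚ
rhs n p = sumTo (n ⊓ p) (λ s →
  ℕtoℚ (2 ℕ.^ s ℕ.* s ℕ.! ℕ.* (p C s) ℕ.* (n C s)) * bigM (p ∸ s) (n ∸ s) s)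

-- Let H_N(y) = Σ_R N!/((N-2R)! R!) y^R. These Hermite-type polynomials satisfy
-- H_{N+1} = H_N + 2N y H_{N-1}, and for the linear functional L_q(y^R) = 1/(R+q)! one has
-- m_n^{(q)} = L_q(H_n) and M_{p,n,t} = L_1(y^t H_p H_n). The theorem is thus L_1 applied to the
-- Nielsen-type linearisation
--   H_{n+p} = Σ_s 2^s s! C(p,s) C(n,s) y^s H_{n-s} H_{p-s},
-- which holds under every linear functional and is proved by induction on n: the right-hand side
-- obeys the recurrence of H_{n+p} in n, by Pascal's rule for C(n+1,s), the recurrence for
-- H_{n+1-s}, and the absorption identities (n-s) C(n,s) = n C(n-1,s), (s+1) C(p,s+1) = p C(p-1,s).
-- A functional L is represented by its moments g R = L(y^R), so multiplication by y is g ∘ suc.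

module Submission where

open import Defs
open import Data.Nat using (ℕ; _+_)
open import Relation.Binary.PropositionalEquality using (_≡_)

open import Data.Integer as ℤ using (+_)
import Data.Integer.Properties as ℤₚ
open import Data.Nat as ℕ using (zero; suc; _*_; _∸_; _^_; _!; _⊓_; _≤_; _<_; _≤′_; z≤n; s≤s; NonZero)
open import Data.Nat.Properties
open import Data.Nat.Combinatorics using (_C_; nC1≡n; nCk+nC[k+1]≡[n+1]C[k+1]; k>n⇒nCk≡0)
open import Data.Nat.DivMod using (m/n*n≤m; m≡m%n+[m/n]*n; m%n<n; m/n≤m)
open import Data.Nat.Tactic.RingSolver using (solve-∀)
open import Data.Rational as ℚ using (ℚ; 0ℚ; _/_; fromℚᵘ)
import Data.Rational.Properties as ℚₚ
open import Data.Rational.Solver using (module +-*-Solver)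
open +-*-Solver using (solve; _:+_; _:*_; _:=_)
open import Data.Rational.Unnormalised as ℚᵘ using (mkℚᵘ; *≡*)
import Data.Rational.Unnormalised.Properties as ℚᵘₚ
open import Data.Sum using (inj₁; inj₂)
open import Function using (_∘_)
open import Relation.Nullary using (yes; no)
open import Relation.Binary.PropositionalEquality
  using (refl; sym; trans; cong; cong₂; subst; module ≡-Reasoning)

ℕtoℚ-*-zeroˡ : ∀ {m} (x : ℚ) → m ≡ 0 → ℕtoℚ m ℚ.* x ≡ 0ℚ
ℕtoℚ-*-zeroˡ x refl = ℚₚ.*-zeroˡ x

sumTo-cong : ∀ k {f g : ℕ → ℚ} → (∀ i → i ≤ k → f i ≡ g i) → sumTo k f ≡ sumTo k g
sumTo-cong zero    f≗g = f≗g 0 z≤n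
sumTo-cong (suc k) f≗g =
  cong₂ ℚ._+_ (sumTo-cong k (λ i i≤k → f≗g i (m≤n⇒m≤1+n i≤k))) (f≗g (suc k) ≤-refl)

sumTo-+ : ∀ k (f g : ℕ → ℚ) → sumTo k (λ i → f i ℚ.+ g i) ≡ sumTo k f ℚ.+ sumTo k g
sumTo-+ zero    f g = refl
sumTo-+ (suc k) f g = trans (cong (ℚ._+ (f (suc k) ℚ.+ g (suc k))) (sumTo-+ k f g))
  (solve 4 (λ a b c d → (a :+ b) :+ (c :+ d) := (a :+ c) :+ (b :+ d)) refl
    (sumTo k f) (sumTo k g) (f (suc k)) (g (suc k)))

sumTo-*ˡ : ∀ k c (f : ℕ → ℚ) → sumTo k (λ i → c ℚ.* f i) ≡ c ℚ.* sumTo k f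
sumTo-*ˡ zero    c f = refl
sumTo-*ˡ (suc k) c f = trans (cong (ℚ._+ c ℚ.* f (suc k)) (sumTo-*ˡ k c f))
  (sym (ℚₚ.*-distribˡ-+ c (sumTo k f) (f (suc k))))

sumTo-suc : ∀ k (f : ℕ → ℚ) → sumTo (suc k) f ≡ f 0 ℚ.+ sumTo k (f ∘ suc)
sumTo-suc zero    f = refl
sumTo-suc (suc k) f = trans (cong (ℚ._+ f (suc (suc k))) (sumTo-suc k f)) (ℚₚ.+-assoc (f 0) _ _)

sumTo-extend : ∀ {k m} (f : ℕ → ℚ) → k ≤ m → (∀ i → k < i → f i ≡ 0ℚ) → sumTo k f ≡ sumTo m f
sumTo-extend {k} f k≤m vanish = go (≤⇒≤′ k≤m)
  where
  go : ∀ {m} → k ≤′ m → sumTo k f ≡ sumTo m f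
  go ℕ.≤′-refl = refl
  go (ℕ.≤′-step {m} k≤′m) = begin
    sumTo k f                      ≡⟨ go k≤′m ⟩
    sumTo m f                      ≡⟨ ℚₚ.+-identityʳ (sumTo m f) ⟨
    sumTo m f ℚ.+ 0ℚ               ≡⟨ cong (sumTo m f ℚ.+_) (vanish (suc m) (s≤s (≤′⇒≤ k≤′m))) ⟨
    sumTo m f ℚ.+ f (suc m)        ∎
    where open ≡-Reasoning

fromℚᵘ-homo-+ : ∀ x y → fromℚᵘ (x ℚᵘ.+ y) ≡ fromℚᵘ x ℚ.+ fromℚᵘ y
fromℚᵘ-homo-+ x y = ℚₚ.toℚᵘ-injective (ℚᵘₚ.≃-trans (ℚₚ.toℚᵘ-fromℚᵘ (x ℚᵘ.+ y))
  (ℚᵘₚ.≃-sym (ℚᵘₚ.≃-trans (ℚₚ.toℚᵘ-homo-+ (fromℚᵘ x) (fromℚᵘ y))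
    (ℚᵘₚ.+-cong (ℚₚ.toℚᵘ-fromℚᵘ x) (ℚₚ.toℚᵘ-fromℚᵘ y)))))

fromℚᵘ-homo-* : ∀ x y → fromℚᵘ (x ℚᵘ.* y) ≡ fromℚᵘ x ℚ.* fromℚᵘ y
fromℚᵘ-homo-* x y = ℚₚ.toℚᵘ-injective (ℚᵘₚ.≃-trans (ℚₚ.toℚᵘ-fromℚᵘ (x ℚᵘ.* y))
  (ℚᵘₚ.≃-sym (ℚᵘₚ.≃-trans (ℚₚ.toℚᵘ-homo-* (fromℚᵘ x) (fromℚᵘ y))
    (ℚᵘₚ.*-cong (ℚₚ.toℚᵘ-fromℚᵘ x) (ℚₚ.toℚᵘ-fromℚᵘ y)))))

/-cong-cross : ∀ a b c d .{{_ : NonZero b}} .{{_ : NonZero d}} →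
               a * d ≡ c * b → (+ a) / b ≡ (+ c) / d
/-cong-cross a (suc b) c (suc d) eq = ℚₚ.fromℚᵘ-cong {mkℚᵘ (+ a) b} {mkℚᵘ (+ c) d}
  (*≡* (trans (sym (ℤₚ.pos-* a (suc d))) (trans (cong +_ eq) (ℤₚ.pos-* c (suc b)))))

/-*-/ : ∀ a b c d .{{_ : NonZero b}} .{{_ : NonZero d}} →
        ((+ a) / b) ℚ.* ((+ c) / d) ≡ ((+ (a * c)) / (b * d)) {{m*n≢0 b d}}
/-*-/ a (suc b) c (suc d) = trans (sym (fromℚᵘ-homo-* (mkℚᵘ (+ a) b) (mkℚᵘ (+ c) d)))
  (ℚₚ.fromℚᵘ-cong {mkℚᵘ (+ a) b ℚᵘ.* mkℚᵘ (+ c) d} {mkℚᵘ (+ (a * c)) (d + b * suc d)}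
    (*≡* (cong₂ ℤ._*_ (sym (ℤₚ.pos-* a c)) refl)))

ℕtoℚ-+ : ∀ a b → ℕtoℚ (a + b) ≡ ℕtoℚ a ℚ.+ ℕtoℚ b
ℕtoℚ-+ a b = trans (ℚₚ.fromℚᵘ-cong {mkℚᵘ (+ (a + b)) 0} {mkℚᵘ (+ a) 0 ℚᵘ.+ mkℚᵘ (+ b) 0} (*≡* cross))
                   (fromℚᵘ-homo-+ (mkℚᵘ (+ a) 0) (mkℚᵘ (+ b) 0))
  where
  cross : + (a + b) ℤ.* + 1 ≡ (+ a ℤ.* + 1 ℤ.+ + b ℤ.* + 1) ℤ.* + 1
  cross rewrite ℤₚ.*-identityʳ (+ a) | ℤₚ.*-identityʳ (+ b) = cong (ℤ._* + 1) (ℤₚ.pos-+ a b)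

ℕtoℚ-* : ∀ a b → ℕtoℚ (a * b) ≡ ℕtoℚ a ℚ.* ℕtoℚ b
ℕtoℚ-* a b = sym (/-*-/ a 1 b 1)

-- The coefficient of y^R in H_N, equal to N!/((N-2R)! R!) by hermiteCoeff-closed.
hermiteCoeff : ℕ → ℕ → ℕ
hermiteCoeff N             zero    = 1
hermiteCoeff zero          (suc R) = 0
hermiteCoeff (suc zero)    (suc R) = 0
hermiteCoeff (suc (suc N)) (suc R) = hermiteCoeff (suc N) (suc R) + 2 * suc N * hermiteCoeff N R

hermiteCoeff-vanishes : ∀ N R → N < 2 * R → hermiteCoeff N R ≡ 0
hermiteCoeff-vanishes zero          (suc R) _  = refl
hermiteCoeff-vanishes (suc zero)    (suc R) _  = refl
hermiteCoeff-vanishes (suc (suc N)) (suc R) lt = cong₂ _+_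
  (hermiteCoeff-vanishes (suc N) (suc R) (<-trans (n<1+n (suc N)) lt))
  (trans (cong (2 * suc N *_) (hermiteCoeff-vanishes N R N<2R)) (*-zeroʳ (2 * suc N)))
  where
  N<2R : N < 2 * R
  N<2R = +-cancelˡ-< 2 N (2 * R) (subst (2 + N <_) (*-suc 2 R) lt)

hermiteCoeff-vanishes-above : ∀ N R → N < R → hermiteCoeff N R ≡ 0
hermiteCoeff-vanishes-above N R N<R = hermiteCoeff-vanishes N R (<-≤-trans N<R (m≤m+n R (R + 0)))

hermiteCoeff-closed-step : ∀ R j → let M = 2 * R + j in
  hermiteCoeff (suc M) (suc R) * (j ! * suc R !) ≡ j * suc M ! →
  hermiteCoeff M R * (j ! * R !) ≡ M ! →
  hermiteCoeff (suc (suc M)) (suc R) * (j ! * suc R !) ≡ suc (suc M) !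
hermiteCoeff-closed-step R j first rest = begin
    (A + 2 * suc M * t) * (j ! * (suc R * R !))
  ≡⟨ distribute M R A t (j !) (R !) ⟩
    A * (j ! * (suc R * R !)) + 2 * suc M * suc R * (t * (j ! * R !))
  ≡⟨ cong₂ (λ x y → x + 2 * suc M * suc R * y) first rest ⟩
    j * (suc M * M !) + 2 * suc M * suc R * M !
  ≡⟨ collect R j (M !) ⟩
    suc (suc M) * (suc M * M !) ∎
  where
  open ≡-Reasoning
  M = 2 * R + j
  A = hermiteCoeff (suc M) (suc R)
  t = hermiteCoeff M R
  distribute : ∀ m r A t f g → (A + 2 * suc m * t) * (f * (suc r * g))
             ≡ A * (f * (suc r * g)) + 2 * suc m * suc r * (t * (f * g))
  distribute = solve-∀
  collect : ∀ r j f → j * (suc (2 * r + j) * f) + 2 * suc (2 * r + j) * suc r * f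
                    ≡ suc (suc (2 * r + j)) * (suc (2 * r + j) * f)
  collect = solve-∀

hermiteCoeff-closed : ∀ R j → hermiteCoeff (2 * R + j) R * (j ! * R !) ≡ (2 * R + j) !
hermiteCoeff-closed zero j = trans (*-identityˡ (j ! * 1)) (*-identityʳ (j !))
hermiteCoeff-closed (suc R) j =
  subst (λ N → hermiteCoeff N (suc R) * (j ! * suc R !) ≡ N !) (sym (2[1+R]+j≡2+[2R+j] R j))
    (hermiteCoeff-closed-step R j (first j) (hermiteCoeff-closed R j))
  where
  2[1+R]+j≡2+[2R+j] : ∀ R j → 2 * suc R + j ≡ suc (suc (2 * R + j))
  2[1+R]+j≡2+[2R+j] = solve-∀
  2[1+R]+j≡1+[2R+[1+j]] : ∀ R j → 2 * suc R + j ≡ suc (2 * R + suc j)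
  2[1+R]+j≡1+[2R+[1+j]] = solve-∀
  rearrange : ∀ x a b c → x * (a * b * c) ≡ a * (x * (b * c))
  rearrange = solve-∀
  first : ∀ i → hermiteCoeff (suc (2 * R + i)) (suc R) * (i ! * suc R !) ≡ i * suc (2 * R + i) !
  first zero    = cong (_* (1 * suc R !)) (hermiteCoeff-vanishes (suc (2 * R + 0)) (suc R)
    (subst (suc (2 * R + 0) <_) (sym (*-suc 2 R)) (s≤s (s≤s (≤-reflexive (+-identityʳ (2 * R)))))))
  first (suc i) = trans (rearrange (hermiteCoeff K (suc R)) (suc i) (i !) (suc R !))
    (cong (suc i *_) (subst (λ N → hermiteCoeff N (suc R) * (i ! * suc R !) ≡ N !)
      (2[1+R]+j≡1+[2R+[1+j]] R i) (hermiteCoeff-closed (suc R) i)))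
    where K = suc (2 * R + suc i)

pTerm-hermiteCoeff : ∀ N R → 2 * R ≤ N → pTerm N R ≡ ℕtoℚ (hermiteCoeff N R)
pTerm-hermiteCoeff N R 2R≤N =
  /-cong-cross (N !) (j ! * R !) (hermiteCoeff N R) 1 {{m*n≢0 (j !) (R !) {{j !≢0}} {{R !≢0}}}} cross
  where
  j = N ∸ 2 * R
  cross : N ! * 1 ≡ hermiteCoeff N R * (j ! * R !)
  cross = trans (*-identityʳ (N !)) (sym (subst (λ K → hermiteCoeff K R * (j ! * R !) ≡ K !)
    (m+[n∸m]≡n 2R≤N) (hermiteCoeff-closed R j)))

hermiteTerm : ℕ → (ℕ → ℚ) → ℕ → ℚ
hermiteTerm N g R = ℕtoℚ (hermiteCoeff N R) ℚ.* g R

hermite : ℕ → (ℕ → ℚ) → ℚ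
hermite N g = sumTo N (hermiteTerm N g)

hermite-cong : ∀ N {g h : ℕ → ℚ} → (∀ R → g R ≡ h R) → hermite N g ≡ hermite N h
hermite-cong N g≗h = sumTo-cong N (λ R _ → cong (ℕtoℚ (hermiteCoeff N R) ℚ.*_) (g≗h R))

hermite-+ : ∀ N (g h : ℕ → ℚ) → hermite N (λ R → g R ℚ.+ h R) ≡ hermite N g ℚ.+ hermite N h
hermite-+ N g h = trans
  (sumTo-cong N (λ R _ → ℚₚ.*-distribˡ-+ (ℕtoℚ (hermiteCoeff N R)) (g R) (h R)))
  (sumTo-+ N _ _)

hermite-*ˡ : ∀ N c (g : ℕ → ℚ) → hermite N (λ R → c ℚ.* g R) ≡ c ℚ.* hermite N g
hermite-*ˡ N c g = trans (sumTo-cong N (λ R _ → swap (ℕtoℚ (hermiteCoeff N R)) (g R))) (sumTo-*ˡ N c _)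
  where
  swap : ∀ a x → a ℚ.* (c ℚ.* x) ≡ c ℚ.* (a ℚ.* x)
  swap a x = solve 3 (λ a c x → a :* (c :* x) := c :* (a :* x)) refl a c x

hermite-pTerm : ∀ N g → hermite N g ≡ sumTo (N ℕ./ 2) (λ R → pTerm N R ℚ.* g R)
hermite-pTerm N g = sym (trans
  (sumTo-cong (N ℕ./ 2) (λ R R≤N/2 → cong (ℚ._* g R) (pTerm-hermiteCoeff N R (2R≤N R≤N/2))))
  (sumTo-extend _ (m/n≤m N 2) λ R N/2<R → ℕtoℚ-*-zeroˡ (g R) (hermiteCoeff-vanishes N R (N<2R N/2<R))))
  where
  2R≤N : ∀ {R} → R ≤ N ℕ./ 2 → 2 * R ≤ N
  2R≤N {R} R≤N/2 = ≤-trans (*-monoʳ-≤ 2 R≤N/2) (subst (_≤ N) (*-comm (N ℕ./ 2) 2) (m/n*n≤m N 2))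
  N<2R : ∀ {R} → N ℕ./ 2 < R → N < 2 * R
  N<2R {R} N/2<R = begin-strict
    N                           ≡⟨ m≡m%n+[m/n]*n N 2 ⟩
    N ℕ.% 2 + (N ℕ./ 2) * 2     <⟨ +-monoˡ-< ((N ℕ./ 2) * 2) (m%n<n N 2) ⟩
    2 + (N ℕ./ 2) * 2           ≡⟨ *-comm (suc (N ℕ./ 2)) 2 ⟩
    2 * suc (N ℕ./ 2)           ≤⟨ *-monoʳ-≤ 2 N/2<R ⟩
    2 * R                       ∎
    where open ≤-Reasoning

hermite-extend : ∀ N {m} g → N ≤ m → hermite N g ≡ sumTo m (hermiteTerm N g)
hermite-extend N g N≤m = sumTo-extend _ N≤m
  (λ R N<R → ℕtoℚ-*-zeroˡ (g R) (hermiteCoeff-vanishes-above N R N<R))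

hermite-suc : ∀ N g →
  hermite (suc N) g ≡ hermite N g ℚ.+ ℕtoℚ (2 * N) ℚ.* hermite (N ∸ 1) (g ∘ suc)
hermite-suc zero g =
  cong (ℕtoℚ 1 ℚ.* g 0 ℚ.+_) (trans (ℚₚ.*-zeroˡ (g 1)) (sym (ℚₚ.*-zeroˡ (ℕtoℚ 1 ℚ.* g 1))))
hermite-suc (suc M) g = begin
    sumTo (suc (suc M)) (hermiteTerm (suc (suc M)) g)
  ≡⟨ sumTo-suc (suc M) _ ⟩
    g₀ ℚ.+ sumTo (suc M) (hermiteTerm (suc (suc M)) g ∘ suc)
  ≡⟨ cong (g₀ ℚ.+_) (trans (sumTo-cong (suc M) (λ R _ → split R)) (sumTo-+ (suc M) _ _)) ⟩
    g₀ ℚ.+ (sumTo (suc M) (hermiteTerm (suc M) g ∘ suc) ℚ.+ S)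
  ≡⟨ ℚₚ.+-assoc g₀ _ S ⟨
    g₀ ℚ.+ sumTo (suc M) (hermiteTerm (suc M) g ∘ suc) ℚ.+ S
  ≡⟨ cong (ℚ._+ S) (sumTo-suc (suc M) (hermiteTerm (suc M) g)) ⟨
    sumTo (suc (suc M)) (hermiteTerm (suc M) g) ℚ.+ S
  ≡⟨ cong₂ ℚ._+_ (hermite-extend (suc M) g (n≤1+n (suc M))) lower ⟨
    hermite (suc M) g ℚ.+ c ℚ.* hermite M (g ∘ suc) ∎
  where
  open ≡-Reasoning
  c = ℕtoℚ (2 * suc M)
  g₀ = hermiteTerm (suc M) g 0
  S = sumTo (suc M) (λ R → c ℚ.* hermiteTerm M (g ∘ suc) R)
  lower : c ℚ.* hermite M (g ∘ suc) ≡ S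
  lower = trans (cong (c ℚ.*_) (hermite-extend M (g ∘ suc) (n≤1+n M))) (sym (sumTo-*ˡ (suc M) c _))
  split : ∀ R → hermiteTerm (suc (suc M)) g (suc R)
              ≡ hermiteTerm (suc M) g (suc R) ℚ.+ c ℚ.* hermiteTerm M (g ∘ suc) R
  split R = begin
      ℕtoℚ (a + 2 * suc M * b) ℚ.* g (suc R)
    ≡⟨ cong (ℚ._* g (suc R)) (trans (ℕtoℚ-+ a _) (cong (ℕtoℚ a ℚ.+_) (ℕtoℚ-* (2 * suc M) b))) ⟩
      (ℕtoℚ a ℚ.+ c ℚ.* ℕtoℚ b) ℚ.* g (suc R)
    ≡⟨ solve 4 (λ a c b x → (a :+ c :* b) :* x := a :* x :+ c :* (b :* x)) refl
               (ℕtoℚ a) c (ℕtoℚ b) (g (suc R)) ⟩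
      ℕtoℚ a ℚ.* g (suc R) ℚ.+ c ℚ.* (ℕtoℚ b ℚ.* g (suc R)) ∎
    where
    a = hermiteCoeff (suc M) (suc R)
    b = hermiteCoeff M R

-- L(H_a H_b).
hermiteProduct : ℕ → ℕ → (ℕ → ℚ) → ℚ
hermiteProduct a b h = hermite b (λ r → hermite a (λ k → h (k + r)))

hermiteProduct-cong : ∀ a b {h h′ : ℕ → ℚ} → (∀ j → h j ≡ h′ j) →
                      hermiteProduct a b h ≡ hermiteProduct a b h′
hermiteProduct-cong a b h≗h′ = hermite-cong b (λ r → hermite-cong a (λ k → h≗h′ (k + r)))

hermiteProduct-suc : ∀ a b h → hermiteProduct (suc a) b h ≡
  hermiteProduct a b h ℚ.+ ℕtoℚ (2 * a) ℚ.* hermiteProduct (a ∸ 1) b (h ∘ suc)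
hermiteProduct-suc a b h = begin
    hermite b (λ r → hermite (suc a) (λ k → h (k + r)))
  ≡⟨ hermite-cong b (λ r → hermite-suc a (λ k → h (k + r))) ⟩
    hermite b (λ r → hermite a (λ k → h (k + r)) ℚ.+ c ℚ.* hermite (a ∸ 1) (λ k → h (suc k + r)))
  ≡⟨ hermite-+ b _ _ ⟩
    hermiteProduct a b h ℚ.+ hermite b (λ r → c ℚ.* hermite (a ∸ 1) (λ k → h (suc k + r)))
  ≡⟨ cong (hermiteProduct a b h ℚ.+_) (hermite-*ˡ b c _) ⟩
    hermiteProduct a b h ℚ.+ c ℚ.* hermiteProduct (a ∸ 1) b (h ∘ suc) ∎
  where
  open ≡-Reasoning
  c = ℕtoℚ (2 * a)

[1+k]*[1+n]C[1+k]≡[1+n]*nCk : ∀ n k → suc k * (suc n C suc k) ≡ suc n * (n C k)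
[1+k]*[1+n]C[1+k]≡[1+n]*nCk zero    zero    = refl
[1+k]*[1+n]C[1+k]≡[1+n]*nCk zero    (suc k) = *-zeroʳ (2 + k)
[1+k]*[1+n]C[1+k]≡[1+n]*nCk (suc n) zero    =
  trans (*-identityˡ _) (trans (nC1≡n (2 + n)) (sym (*-identityʳ (2 + n))))
[1+k]*[1+n]C[1+k]≡[1+n]*nCk (suc n) (suc k) = begin
    (2 + k) * ((2 + n) C (2 + k))
  ≡⟨ cong ((2 + k) *_) (nCk+nC[k+1]≡[n+1]C[k+1] (suc n) (suc k)) ⟨
    (2 + k) * (X + Y)
  ≡⟨ expand X Y k ⟩
    X + suc k * X + (2 + k) * Y
  ≡⟨ cong₂ (λ a b → X + a + b) ([1+k]*[1+n]C[1+k]≡[1+n]*nCk n k)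
                                ([1+k]*[1+n]C[1+k]≡[1+n]*nCk n (suc k)) ⟩
    X + suc n * (n C k) + suc n * (n C suc k)
  ≡⟨ cong (λ x → x + suc n * (n C k) + suc n * (n C suc k)) (nCk+nC[k+1]≡[n+1]C[k+1] n k) ⟨
    (n C k) + (n C suc k) + suc n * (n C k) + suc n * (n C suc k)
  ≡⟨ collect (n C k) (n C suc k) n ⟩
    (2 + n) * ((n C k) + (n C suc k))
  ≡⟨ cong ((2 + n) *_) (nCk+nC[k+1]≡[n+1]C[k+1] n k) ⟩
    (2 + n) * X ∎
  where
  open ≡-Reasoning
  X = suc n C suc k
  Y = suc n C (2 + k)
  expand : ∀ X Y k → (2 + k) * (X + Y) ≡ X + suc k * X + (2 + k) * Y
  expand = solve-∀
  collect : ∀ a b n → a + b + suc n * a + suc n * b ≡ (2 + n) * (a + b)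
  collect = solve-∀

[1+n∸k]*[1+n]Ck≡[1+n]*nCk : ∀ n k → (suc n ∸ k) * (suc n C k) ≡ suc n * (n C k)
[1+n∸k]*[1+n]Ck≡[1+n]*nCk n zero = refl
[1+n∸k]*[1+n]Ck≡[1+n]*nCk n (suc k) with k ≤? n
... | no  k≰n = trans (cong (_* X) (m≤n⇒m∸n≡0 (<⇒≤ (≰⇒> k≰n))))
                  (sym (trans (cong (suc n *_) (k>n⇒nCk≡0 (m<n⇒m<1+n (≰⇒> k≰n)))) (*-zeroʳ (suc n))))
  where X = suc n C suc k
... | yes k≤n = +-cancelʳ-≡ (suc k * X) _ _ (begin
    (n ∸ k) * X + suc k * X
  ≡⟨ *-distribʳ-+ X (n ∸ k) (suc k) ⟨
    ((n ∸ k) + suc k) * X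
  ≡⟨ cong (_* X) (trans (+-suc (n ∸ k) k) (cong suc (m∸n+n≡m k≤n))) ⟩
    suc n * X
  ≡⟨ cong (suc n *_) (nCk+nC[k+1]≡[n+1]C[k+1] n k) ⟨
    suc n * (n C k + n C suc k)
  ≡⟨ trans (*-distribˡ-+ (suc n) (n C k) (n C suc k)) (+-comm (suc n * (n C k)) _) ⟩
    suc n * (n C suc k) + suc n * (n C k)
  ≡⟨ cong (_+_ (suc n * (n C suc k))) ([1+k]*[1+n]C[1+k]≡[1+n]*nCk n k) ⟨
    suc n * (n C suc k) + suc k * X ∎)
  where
  open ≡-Reasoning
  X = suc n C suc k

nielsenCoeff : ℕ → ℕ → ℕ → ℕ
nielsenCoeff n p s = 2 ^ s * s ! * (p C s) * (n C s)

nielsenCoeff-vanishes : ∀ n p s → n < s → nielsenCoeff n p s ≡ 0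
nielsenCoeff-vanishes n p s n<s =
  trans (cong (2 ^ s * s ! * (p C s) *_) (k>n⇒nCk≡0 n<s)) (*-zeroʳ (2 ^ s * s ! * (p C s)))

nielsenCoeff-absorb-n : ∀ n p s → nielsenCoeff n p s * (2 * (n ∸ s)) ≡ 2 * n * nielsenCoeff (n ∸ 1) p s
nielsenCoeff-absorb-n zero    p s =
  trans (cong (λ x → nielsenCoeff 0 p s * (2 * x)) (0∸n≡0 s)) (*-zeroʳ (nielsenCoeff 0 p s))
nielsenCoeff-absorb-n (suc n) p s = begin
    P * (suc n C s) * (2 * (suc n ∸ s))
  ≡⟨ regroup P (suc n C s) (suc n ∸ s) ⟩
    2 * ((suc n ∸ s) * (suc n C s)) * P
  ≡⟨ cong (λ x → 2 * x * P) ([1+n∸k]*[1+n]Ck≡[1+n]*nCk n s) ⟩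
    2 * (suc n * (n C s)) * P
  ≡⟨ reassociate P (n C s) n ⟩
    2 * suc n * (P * (n C s)) ∎
  where
  open ≡-Reasoning
  P = 2 ^ s * s ! * (p C s)
  regroup : ∀ P b d → P * b * (2 * d) ≡ 2 * (d * b) * P
  regroup = solve-∀
  reassociate : ∀ P b n → 2 * (suc n * b) * P ≡ 2 * suc n * (P * b)
  reassociate = solve-∀

nielsenCoeff-absorb-p : ∀ n p s →
  2 ^ suc s * suc s ! * (p C suc s) * (n C s) ≡ 2 * p * nielsenCoeff n (p ∸ 1) s
nielsenCoeff-absorb-p n zero    s = cong (_* (n C s)) (*-zeroʳ (2 ^ suc s * suc s !))
nielsenCoeff-absorb-p n (suc p) s = begin
    2 * 2 ^ s * (suc s * s !) * (suc p C suc s) * (n C s)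
  ≡⟨ regroup (2 ^ s) (s !) s (suc p C suc s) (n C s) ⟩
    2 * (2 ^ s * s !) * (suc s * (suc p C suc s)) * (n C s)
  ≡⟨ cong (λ x → 2 * (2 ^ s * s !) * x * (n C s)) ([1+k]*[1+n]C[1+k]≡[1+n]*nCk p s) ⟩
    2 * (2 ^ s * s !) * (suc p * (p C s)) * (n C s)
  ≡⟨ reassociate (2 ^ s) (s !) p (p C s) (n C s) ⟩
    2 * suc p * (2 ^ s * s ! * (p C s) * (n C s)) ∎
  where
  open ≡-Reasoning
  regroup : ∀ e f s x y → 2 * e * (suc s * f) * x * y ≡ 2 * (e * f) * (suc s * x) * y
  regroup = solve-∀
  reassociate : ∀ e f p x y → 2 * (e * f) * (suc p * x) * y ≡ 2 * suc p * (e * f * x * y)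
  reassociate = solve-∀

-- L(2^s s! C(p,s) C(n,s) y^s H_{n-s} H_{p-s}).
nielsenTerm : ℕ → ℕ → (ℕ → ℚ) → ℕ → ℚ
nielsenTerm n p g s = ℕtoℚ (nielsenCoeff n p s) ℚ.* hermiteProduct (n ∸ s) (p ∸ s) (λ j → g (s + j))

linearisation : ℕ → ℕ → (ℕ → ℚ) → ℚ
linearisation n p g = sumTo n (nielsenTerm n p g)

linearisation-extend : ∀ n {m} p g → n ≤ m → linearisation n p g ≡ sumTo m (nielsenTerm n p g)
linearisation-extend n p g n≤m = sumTo-extend _ n≤m
  (λ s n<s → ℕtoℚ-*-zeroˡ _ (nielsenCoeff-vanishes n p s n<s))

-- The two parts of nielsenTerm (suc n) p g that Pascal's rule C(n+1,s) = C(n,s) + C(n,s-1) separates.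
raisedTerm loweredTerm : ℕ → ℕ → (ℕ → ℚ) → ℕ → ℚ
raisedTerm n p g s =
  ℕtoℚ (nielsenCoeff n p s) ℚ.* hermiteProduct (suc n ∸ s) (p ∸ s) (λ j → g (s + j))
loweredTerm n p g s = ℕtoℚ (2 ^ suc s * suc s ! * (p C suc s) * (n C s))
  ℚ.* hermiteProduct (n ∸ s) (p ∸ suc s) (λ j → g (suc s + j))

sum-raisedTerm : ∀ n p (g : ℕ → ℚ) → sumTo (suc n) (raisedTerm n p g)
  ≡ linearisation n p g ℚ.+ ℕtoℚ (2 * n) ℚ.* linearisation (n ∸ 1) p (g ∘ suc)
sum-raisedTerm n p g = begin
    sumTo (suc n) (raisedTerm n p g)
  ≡⟨ sumTo-extend _ (n≤1+n n) (λ s n<s → ℕtoℚ-*-zeroˡ _ (nielsenCoeff-vanishes n p s n<s)) ⟨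
    sumTo n (raisedTerm n p g)
  ≡⟨ sumTo-cong n split ⟩
    sumTo n (λ s → nielsenTerm n p g s ℚ.+ c ℚ.* nielsenTerm (n ∸ 1) p (g ∘ suc) s)
  ≡⟨ trans (sumTo-+ n _ _) (cong (linearisation n p g ℚ.+_) (sumTo-*ˡ n c _)) ⟩
    linearisation n p g ℚ.+ c ℚ.* sumTo n (nielsenTerm (n ∸ 1) p (g ∘ suc))
  ≡⟨ cong (λ x → linearisation n p g ℚ.+ c ℚ.* x)
          (linearisation-extend (n ∸ 1) p (g ∘ suc) (m∸n≤m n 1)) ⟨
    linearisation n p g ℚ.+ c ℚ.* linearisation (n ∸ 1) p (g ∘ suc) ∎
  where
  open ≡-Reasoning
  c = ℕtoℚ (2 * n)
  split : ∀ s → s ≤ n →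
          raisedTerm n p g s ≡ nielsenTerm n p g s ℚ.+ c ℚ.* nielsenTerm (n ∸ 1) p (g ∘ suc) s
  split s s≤n = begin
      ℕtoℚ k ℚ.* hermiteProduct (suc n ∸ s) (p ∸ s) h
    ≡⟨ cong (λ a → ℕtoℚ k ℚ.* hermiteProduct a (p ∸ s) h) (+-∸-assoc 1 s≤n) ⟩
      ℕtoℚ k ℚ.* hermiteProduct (suc (n ∸ s)) (p ∸ s) h
    ≡⟨ cong (ℕtoℚ k ℚ.*_) (hermiteProduct-suc (n ∸ s) (p ∸ s) h) ⟩
      ℕtoℚ k ℚ.* (Z₁ ℚ.+ ℕtoℚ d ℚ.* Z₂)
    ≡⟨ solve 4 (λ k z₁ d z₂ → k :* (z₁ :+ d :* z₂) := k :* z₁ :+ (k :* d) :* z₂) refl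
               (ℕtoℚ k) Z₁ (ℕtoℚ d) Z₂ ⟩
      ℕtoℚ k ℚ.* Z₁ ℚ.+ ℕtoℚ k ℚ.* ℕtoℚ d ℚ.* Z₂
    ≡⟨ cong (λ x → ℕtoℚ k ℚ.* Z₁ ℚ.+ x ℚ.* Z₂) coefficient ⟩
      nielsenTerm n p g s ℚ.+ c ℚ.* ℕtoℚ k′ ℚ.* Z₂
    ≡⟨ cong (nielsenTerm n p g s ℚ.+_)
            (trans (ℚₚ.*-assoc c (ℕtoℚ k′) Z₂) (cong (λ x → c ℚ.* (ℕtoℚ k′ ℚ.* x)) shifted)) ⟩
      nielsenTerm n p g s ℚ.+ c ℚ.* nielsenTerm (n ∸ 1) p (g ∘ suc) s ∎
    where
    k = nielsenCoeff n p s
    k′ = nielsenCoeff (n ∸ 1) p s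
    d = 2 * (n ∸ s)
    h : ℕ → ℚ
    h j = g (s + j)
    Z₁ = hermiteProduct (n ∸ s) (p ∸ s) h
    Z₂ = hermiteProduct ((n ∸ s) ∸ 1) (p ∸ s) (h ∘ suc)
    coefficient : ℕtoℚ k ℚ.* ℕtoℚ d ≡ c ℚ.* ℕtoℚ k′
    coefficient = trans (sym (ℕtoℚ-* k d))
      (trans (cong ℕtoℚ (nielsenCoeff-absorb-n n p s)) (ℕtoℚ-* (2 * n) k′))
    [n∸s]∸1≡[n∸1]∸s : (n ∸ s) ∸ 1 ≡ (n ∸ 1) ∸ s
    [n∸s]∸1≡[n∸1]∸s = trans (∸-+-assoc n s 1) (trans (cong (n ∸_) (+-comm s 1)) (sym (∸-+-assoc n 1 s)))
    shifted : Z₂ ≡ hermiteProduct ((n ∸ 1) ∸ s) (p ∸ s) (λ j → g (suc (s + j)))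
    shifted = trans (cong (λ a → hermiteProduct a (p ∸ s) (h ∘ suc)) [n∸s]∸1≡[n∸1]∸s)
      (hermiteProduct-cong ((n ∸ 1) ∸ s) (p ∸ s) (λ j → cong g (+-suc s j)))

sum-loweredTerm : ∀ n p (g : ℕ → ℚ) →
  sumTo n (loweredTerm n p g) ≡ ℕtoℚ (2 * p) ℚ.* linearisation n (p ∸ 1) (g ∘ suc)
sum-loweredTerm n p g = trans (sumTo-cong n (λ s _ → lower s)) (sumTo-*ˡ n (ℕtoℚ (2 * p)) _)
  where
  lower : ∀ s → loweredTerm n p g s ≡ ℕtoℚ (2 * p) ℚ.* nielsenTerm n (p ∸ 1) (g ∘ suc) s
  lower s = begin
      ℕtoℚ (2 ^ suc s * suc s ! * (p C suc s) * (n C s)) ℚ.* hermiteProduct (n ∸ s) (p ∸ suc s) h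
    ≡⟨ cong₂ (λ k b → ℕtoℚ k ℚ.* hermiteProduct (n ∸ s) b h)
             (nielsenCoeff-absorb-p n p s) (sym (∸-+-assoc p 1 s)) ⟩
      ℕtoℚ (2 * p * k′) ℚ.* Z
    ≡⟨ cong (ℚ._* Z) (ℕtoℚ-* (2 * p) k′) ⟩
      ℕtoℚ (2 * p) ℚ.* ℕtoℚ k′ ℚ.* Z
    ≡⟨ ℚₚ.*-assoc (ℕtoℚ (2 * p)) (ℕtoℚ k′) Z ⟩
      ℕtoℚ (2 * p) ℚ.* nielsenTerm n (p ∸ 1) (g ∘ suc) s ∎
    where
    open ≡-Reasoning
    h : ℕ → ℚ
    h j = g (suc s + j)
    k′ = nielsenCoeff n (p ∸ 1) s
    Z = hermiteProduct (n ∸ s) ((p ∸ 1) ∸ s) h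

linearisation-suc : ∀ n p (g : ℕ → ℚ) → linearisation (suc n) p g ≡
  linearisation n p g ℚ.+ ℕtoℚ (2 * n) ℚ.* linearisation (n ∸ 1) p (g ∘ suc)
                      ℚ.+ ℕtoℚ (2 * p) ℚ.* linearisation n (p ∸ 1) (g ∘ suc)
linearisation-suc n p g = begin
    sumTo (suc n) (nielsenTerm (suc n) p g)
  ≡⟨ sumTo-suc n _ ⟩
    raised 0 ℚ.+ sumTo n (nielsenTerm (suc n) p g ∘ suc)
  ≡⟨ cong (raised 0 ℚ.+_) (trans (sumTo-cong n (λ s _ → pascal s)) (sumTo-+ n _ _)) ⟩
    raised 0 ℚ.+ (sumTo n (raised ∘ suc) ℚ.+ sumTo n lowered)
  ≡⟨ ℚₚ.+-assoc (raised 0) _ _ ⟨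
    raised 0 ℚ.+ sumTo n (raised ∘ suc) ℚ.+ sumTo n lowered
  ≡⟨ cong (ℚ._+ sumTo n lowered) (sumTo-suc n raised) ⟨
    sumTo (suc n) raised ℚ.+ sumTo n lowered
  ≡⟨ cong₂ ℚ._+_ (sum-raisedTerm n p g) (sum-loweredTerm n p g) ⟩
    linearisation n p g ℚ.+ ℕtoℚ (2 * n) ℚ.* linearisation (n ∸ 1) p (g ∘ suc)
                        ℚ.+ ℕtoℚ (2 * p) ℚ.* linearisation n (p ∸ 1) (g ∘ suc) ∎
  where
  open ≡-Reasoning
  raised lowered : ℕ → ℚ
  raised = raisedTerm n p g
  lowered = loweredTerm n p g
  pascal : ∀ s → nielsenTerm (suc n) p g (suc s) ≡ raised (suc s) ℚ.+ lowered s
  pascal s = begin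
      ℕtoℚ (Q * (suc n C suc s)) ℚ.* W
    ≡⟨ cong (λ x → ℕtoℚ (Q * x) ℚ.* W) (nCk+nC[k+1]≡[n+1]C[k+1] n s) ⟨
      ℕtoℚ (Q * ((n C s) + (n C suc s))) ℚ.* W
    ≡⟨ cong (λ x → ℕtoℚ x ℚ.* W) (trans (*-distribˡ-+ Q (n C s) (n C suc s)) (+-comm (Q * (n C s)) _)) ⟩
      ℕtoℚ (Q * (n C suc s) + Q * (n C s)) ℚ.* W
    ≡⟨ cong (ℚ._* W) (ℕtoℚ-+ (Q * (n C suc s)) (Q * (n C s))) ⟩
      (ℕtoℚ (Q * (n C suc s)) ℚ.+ ℕtoℚ (Q * (n C s))) ℚ.* W
    ≡⟨ ℚₚ.*-distribʳ-+ W (ℕtoℚ (Q * (n C suc s))) (ℕtoℚ (Q * (n C s))) ⟩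
      raised (suc s) ℚ.+ lowered s ∎
    where
    Q = 2 ^ suc s * suc s ! * (p C suc s)
    W = hermiteProduct (n ∸ s) (p ∸ suc s) (λ j → g (suc s + j))

hermite-linearisation : ∀ n p (g : ℕ → ℚ) → hermite (n + p) g ≡ linearisation n p g
hermite-linearisation zero p g =
  sym (trans (ℚₚ.*-identityˡ _) (hermite-cong p (λ r → ℚₚ.*-identityˡ (g r))))
hermite-linearisation (suc n) p g = begin
    hermite (suc (n + p)) g
  ≡⟨ hermite-suc (n + p) g ⟩
    hermite (n + p) g ℚ.+ ℕtoℚ (2 * (n + p)) ℚ.* X
  ≡⟨ cong (λ c → hermite (n + p) g ℚ.+ c ℚ.* X)
          (trans (cong ℕtoℚ (*-distribˡ-+ 2 n p)) (ℕtoℚ-+ (2 * n) (2 * p))) ⟩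
    hermite (n + p) g ℚ.+ (ℕtoℚ (2 * n) ℚ.+ ℕtoℚ (2 * p)) ℚ.* X
  ≡⟨ solve 4 (λ h a b x → h :+ (a :+ b) :* x := h :+ a :* x :+ b :* x) refl
             (hermite (n + p) g) (ℕtoℚ (2 * n)) (ℕtoℚ (2 * p)) X ⟩
    hermite (n + p) g ℚ.+ ℕtoℚ (2 * n) ℚ.* X ℚ.+ ℕtoℚ (2 * p) ℚ.* X
  ≡⟨ cong₂ ℚ._+_ (cong₂ ℚ._+_ (hermite-linearisation n p g) (lower-n n)) (lower-p p) ⟩
    linearisation n p g ℚ.+ ℕtoℚ (2 * n) ℚ.* linearisation (n ∸ 1) p (g ∘ suc)
                        ℚ.+ ℕtoℚ (2 * p) ℚ.* linearisation n (p ∸ 1) (g ∘ suc)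
  ≡⟨ linearisation-suc n p g ⟨
    linearisation (suc n) p g ∎
  where
  open ≡-Reasoning
  X = hermite ((n + p) ∸ 1) (g ∘ suc)
  0*x≡0*y : ∀ x y → ℕtoℚ 0 ℚ.* x ≡ ℕtoℚ 0 ℚ.* y
  0*x≡0*y x y = trans (ℚₚ.*-zeroˡ x) (sym (ℚₚ.*-zeroˡ y))
  lower-n : ∀ m → ℕtoℚ (2 * m) ℚ.* hermite ((m + p) ∸ 1) (g ∘ suc)
                ≡ ℕtoℚ (2 * m) ℚ.* linearisation (m ∸ 1) p (g ∘ suc)
  lower-n zero    = 0*x≡0*y (hermite (p ∸ 1) (g ∘ suc)) (linearisation 0 p (g ∘ suc))
  lower-n (suc m) = cong (ℕtoℚ (2 * suc m) ℚ.*_) (hermite-linearisation m p (g ∘ suc))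
  lower-p : ∀ q → ℕtoℚ (2 * q) ℚ.* hermite ((n + q) ∸ 1) (g ∘ suc)
                ≡ ℕtoℚ (2 * q) ℚ.* linearisation n (q ∸ 1) (g ∘ suc)
  lower-p zero    = 0*x≡0*y (hermite ((n + 0) ∸ 1) (g ∘ suc)) (linearisation n 0 (g ∘ suc))
  lower-p (suc q) = cong (ℕtoℚ (2 * suc q) ℚ.*_)
    (trans (cong (λ m → hermite (m ∸ 1) (g ∘ suc)) (+-suc n q)) (hermite-linearisation n q (g ∘ suc)))

inverseFactorial : ℕ → ℚ
inverseFactorial k = ((+ 1) / k !) {{k !≢0}}

mTerm≡pTerm*inverseFactorial : ∀ n q r → mTerm n q r ≡ pTerm n r ℚ.* inverseFactorial (r + q)
mTerm≡pTerm*inverseFactorial n q r = sym (trans (/-*-/ (n !) (a * b) 1 c {{ab≢0}} {{c≢0}})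
  (/-cong-cross (n ! * 1) (a * b * c) (n !) (a * b * c) {{abc≢0}} {{abc≢0}}
    (cong (_* (a * b * c)) (*-identityʳ (n !)))))
  where
  a = (n ∸ 2 * r) !
  b = r !
  c = (r + q) !
  ab≢0 : NonZero (a * b)
  ab≢0 = m*n≢0 a b {{(n ∸ 2 * r) !≢0}} {{r !≢0}}
  c≢0 : NonZero c
  c≢0 = (r + q) !≢0
  abc≢0 : NonZero (a * b * c)
  abc≢0 = m*n≢0 (a * b) c {{ab≢0}} {{c≢0}}

assocMotzkin-hermite : ∀ N q → assocMotzkin N q ≡ hermite N (λ R → inverseFactorial (R + q))
assocMotzkin-hermite N q = trans (sumTo-cong (N ℕ./ 2) (λ r _ → mTerm≡pTerm*inverseFactorial N q r))
                                 (sym (hermite-pTerm N _))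

bigM-hermiteProduct : ∀ p n t → bigM p n t ≡ hermiteProduct n p (λ j → inverseFactorial (t + j + 1))
bigM-hermiteProduct p n t = trans (sym (hermite-pTerm p _)) (hermite-cong p (λ r →
  trans (assocMotzkin-hermite n (t + r + 1))
        (hermite-cong n (λ k → cong inverseFactorial (reindex k t r)))))
  where
  reindex : ∀ k t r → k + (t + r + 1) ≡ t + (k + r) + 1
  reindex = solve-∀

nielsenCoeff-vanishes-⊓ : ∀ n p s → n ⊓ p < s → nielsenCoeff n p s ≡ 0
nielsenCoeff-vanishes-⊓ n p s n⊓p<s with ≤-total n p
... | inj₁ n≤p = nielsenCoeff-vanishes n p s (subst (_< s) (m≤n⇒m⊓n≡m n≤p) n⊓p<s)
... | inj₂ p≤n =
  trans (cong (λ x → 2 ^ s * s ! * x * (n C s)) (k>n⇒nCk≡0 (subst (_< s) (m≥n⇒m⊓n≡n p≤n) n⊓p<s)))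
        (cong (_* (n C s)) (*-zeroʳ (2 ^ s * s !)))

mainTheorem4 : (n p : ℕ) → motzkin (n + p) ≡ rhs n p
mainTheorem4 n p = begin
    motzkin (n + p)
  ≡⟨ assocMotzkin-hermite (n + p) 1 ⟩
    hermite (n + p) g
  ≡⟨ hermite-linearisation n p g ⟩
    linearisation n p g
  ≡⟨ sumTo-cong n (λ s _ → cong (ℕtoℚ (nielsenCoeff n p s) ℚ.*_)
                                (sym (bigM-hermiteProduct (p ∸ s) (n ∸ s) s))) ⟩
    sumTo n (λ s → ℕtoℚ (nielsenCoeff n p s) ℚ.* bigM (p ∸ s) (n ∸ s) s)
  ≡⟨ sumTo-extend _ (m⊓n≤m n p) (λ s n⊓p<s → ℕtoℚ-*-zeroˡ _ (nielsenCoeff-vanishes-⊓ n p s n⊓p<s)) ⟨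
    rhs n p ∎
  where
  open ≡-Reasoning
  g : ℕ → ℚ
  g R = inverseFactorial (R + 1)
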